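{- Every non-empty fourling shape $D$ has zero sign-imbalance: $I_D=0$.
   Context: A shape is the Ferrers diagram of an integer partition. A fourling is a $2\times2$ square; a fourling shape is a (possibly empty) shape that is a union of fourlings, i.e. a shape $\mu$ with $\mu_{2i-1}=\mu_{2i}$ even for all $i$. A standard Young tableau (SYT) on an $n$-shape is a filling with $1,\ldots,n$, each once, increasing along rows and down columns. The sign $\mathrm{sgn}(T)$ of a tableau is the sign of the word obtained by reading its entries row by row, left to right, top to bottom; the sign of a word of distinct integers is $(-1)^{\#\text{inversions}}$. $I_D=\sum_{T\in\mathrm{SYT}(D)}\mathrm{sgn}(T)$. -}

module Defs where

open import Data.Nat using (ℕ; zero; suc; _<_; _≤_; _≥_; _<?_)
open import Data.Nat.Divisibility using (_∣_)
open import Data.Integer using (ℤ) renaming (_+_ to _+ℤ_; _*_ to _*ℤ_)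
import Data.Integer as ℤ
open import Data.List using (List; []; _∷_; length; filter; map; concat; zip; foldr; upTo)
open import Data.Nat.ListAction using (sum)
open import Data.List.Relation.Unary.All using (All)
open import Data.List.Relation.Unary.Linked using (Linked)
open import Data.List.Relation.Binary.Permutation.Propositional using (_↭_)
open import Data.Product using (_×_; proj₁; proj₂)
open import Relation.Binary.PropositionalEquality using (_≡_)

-- A shape (Ferrers diagram) is given by its list of row lengths:
-- positive and weakly decreasing.
IsShape : List ℕ → Set
IsShape λs = All (0 <_) λs × Linked _≥_ λs

data IsFourling : List ℕ → Set where
  fl-nil  : IsFourling []
  fl-cons : ∀ {a b rest} → a ≡ b → 2 ∣ a → IsFourling rest → IsFourling (a ∷ b ∷ rest)

size : List ℕ → ℕ
size = sum

-- A filling is a list of rows (top to bottom), each row read left to right.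
Filling : Set
Filling = List (List ℕ)

-- Column condition between a row r and the row r' directly below it
-- (r' is not longer than r, so zip pairs exactly the cells of r').
ColInc : List ℕ → List ℕ → Set
ColInc r r' = All (λ p → proj₁ p < proj₂ p) (zip r r')

IsSYT : List ℕ → Filling → Set
IsSYT D T =
  map length T ≡ D
  × concat T ↭ map suc (upTo (size D))
  × All (Linked _<_) T
  × Linked ColInc T

inv : List ℕ → ℕ
inv [] = 0
inv (x ∷ xs) = length (filter (_<? x) xs) Data.Nat.+ inv xs

negOnePow : ℕ → ℤ
negOnePow zero = ℤ.+ 1
negOnePow (suc k) = ℤ.- negOnePow k

sgn : Filling → ℤ
sgn T = negOnePow (inv (concat T))

sumℤ : List ℤ → ℤ
sumℤ = foldr _+ℤ_ (ℤ.+ 0)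

-- Let s_k swap the entries k and k + 1 of a standard Young tableau unless they lie in adjacent
-- cells; s_k is an involution of SYT(D), so promotion ∂ = s_{n-1} ∘ ⋯ ∘ s_1 is a bijection of
-- SYT(D).  Colour cell (i, j) by (-1)^(i+j) and follow the entry k through s_k: if k and k + 1
-- are adjacent, T is unchanged and k + 1 sits in a cell of the opposite colour; otherwise sgn T
-- changes sign and k + 1 takes over the cell of k.  Either way sgn T times the colour
-- of the tracked cell changes sign, so sgn(∂T)·colour(n) = (-1)^(n-1)·sgn(T)·colour(1).  In a
-- fourling shape 1 sits at (0, 0), n sits at an outer corner, which has i + j even, and n is
-- even; hence sgn(∂T) = -sgn(T), and ∂ pairs off the terms of I_D.

module Submission where

open import Defs
open import Data.Nat using (ℕ; zero; suc; _+_; _*_; _∸_; _<_; _≤_; _≥_; z≤n; s≤s)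
open import Data.Nat.Properties
open import Data.Nat.Divisibility using (_∣_; divides; _∣0; ∣m∣n⇒∣m+n)
open import Data.Integer using (ℤ; +_; -_) renaming (_+_ to _+ℤ_; _*_ to _*ℤ_)
import Data.Integer.Properties as ℤ
open import Data.List using (List; []; _∷_; map; length; filter; concat; _++_; zip; upTo)
open import Data.List.Properties
  using (filter-accept; filter-reject; map-id; map-∘; map-cong; map-cong-local; map-++; zip-map; length-map; concat-map)
open import Data.List.Relation.Unary.All as All using (All; []; _∷_)
open import Data.List.Relation.Unary.AllPairs using (AllPairs; []; _∷_)
open import Data.List.Membership.Propositional using (_∈_; _∉_; find)
open import Data.List.Relation.Unary.Any as Any using (Any; here; there)
open import Data.List.Relation.Unary.Unique.Propositional using (Unique)
open import Data.List.Relation.Binary.Disjoint.Propositional using (Disjoint)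
import Data.List.Relation.Unary.Any.Properties as AnyP
import Data.List.Relation.Unary.All.Properties as AllP
open import Data.List.Relation.Unary.Unique.Propositional.Properties as UniqueP using (Unique[x∷xs]⇒x∉xs)
open import Data.List.Relation.Unary.Linked using (Linked; []; [-]; _∷_)
import Data.List.Relation.Unary.Linked.Properties as LinkedP
open import Data.List.Relation.Binary.Permutation.Propositional using (_↭_; ↭-sym; ↭-trans; ↭⇒↭ₛ)
import Data.List.Relation.Binary.Permutation.Setoid.Properties as PermSetoidP
import Data.List.Relation.Binary.Permutation.Propositional.Properties as PermP
open import Data.List.Relation.Binary.BagAndSetEquality using (∼bag⇒↭)
open import Data.List.Membership.Propositional.Properties using (∈-map⁺; ∈-map⁻; ∈-upTo⁺; ∈-upTo⁻)
open import Data.List.Membership.Propositional.Properties.WithK using (unique∧set⇒bag)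
import Data.Product as Product
open import Data.Product.Properties using (≡-dec)
open import Data.Product using (_×_; _,_; proj₁; proj₂; ∃; ∃₂)
open import Data.Sum as Sum using (_⊎_; inj₁; inj₂)
open import Data.Empty using (⊥-elim)
open import Function using (_∘_; id)
open import Function.Bundles using (_⇔_; mk⇔; Equivalence)
open import Relation.Nullary using (¬_; Dec; yes; no; _⊎-dec_)
open import Relation.Binary.PropositionalEquality

private module PermS = PermSetoidP (setoid ℕ)

map-involutive : ∀ {A : Set} {f : A → A} → (∀ x → f (f x) ≡ x) → ∀ xs → map f (map f xs) ≡ xs
map-involutive {f = f} f-inv xs = begin
  map f (map f xs)  ≡⟨ map-∘ xs ⟨
  map (f ∘ f) xs    ≡⟨ map-cong f-inv xs ⟩
  map id xs         ≡⟨ map-id xs ⟩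
  xs                ∎
  where open ≡-Reasoning

Unique-++⁻ : ∀ {A : Set} (xs : List A) {ys} → Unique (xs ++ ys) → Unique xs × Unique ys × Disjoint xs ys
Unique-++⁻ [] uniq = [] , uniq , λ ()
Unique-++⁻ (x ∷ xs) (x∉ ∷ uniq) =
  let uniqxs , uniqys , disjoint = Unique-++⁻ xs uniq
      x∉xs , x∉ys = AllP.++⁻ xs x∉
  in (x∉xs ∷ uniqxs) , uniqys , λ where
       (here refl , v∈ys) → All.lookup x∉ys v∈ys refl
       (there v∈xs , v∈ys) → disjoint (v∈xs , v∈ys)

map-↭-self : ∀ {A : Set} {f g : A → A} {xs : List A} → Unique xs →
             (∀ x → g (f x) ≡ x) → (∀ x → f (g x) ≡ x) →
             (∀ {x} → x ∈ xs → f x ∈ xs) → (∀ {x} → x ∈ xs → g x ∈ xs) → map f xs ↭ xs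
map-↭-self {f = f} {g} {xs} uniq g∘f≗id f∘g≗id f-closed g-closed =
  ∼bag⇒↭ (unique∧set⇒bag (UniqueP.map⁺ f-injective uniq) uniq (mk⇔ to from))
  where
  f-injective : ∀ {x y} → f x ≡ f y → x ≡ y
  f-injective {x} {y} eq = trans (sym (g∘f≗id x)) (trans (cong g eq) (g∘f≗id y))
  to : ∀ {y} → y ∈ map f xs → y ∈ xs
  to y∈ with ∈-map⁻ f y∈
  ... | _ , x∈xs , refl = f-closed x∈xs
  from : ∀ {y} → y ∈ xs → y ∈ map f xs
  from {y} y∈xs = subst (_∈ map f xs) (f∘g≗id y) (∈-map⁺ f (g-closed y∈xs))

sumℤ-↭ : ∀ {xs ys} → xs ↭ ys → sumℤ xs ≡ sumℤ ys
sumℤ-↭ xs↭ys = PermSetoidP.foldr-commMonoid (setoid ℤ) ℤ.+-0-isCommutativeMonoid (↭⇒↭ₛ xs↭ys)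

sumℤ-neg : ∀ xs → sumℤ (map -_ xs) ≡ - sumℤ xs
sumℤ-neg [] = refl
sumℤ-neg (x ∷ xs) = trans (cong (- x +ℤ_) (sumℤ-neg xs)) (sym (ℤ.neg-distrib-+ x (sumℤ xs)))

i≡-i⇒i≡0 : ∀ {i} → i ≡ - i → i ≡ + 0
i≡-i⇒i≡0 {+ zero} _ = refl

sumℤ-sign-reversing : ∀ {A : Set} {f g : A → A} (w : A → ℤ) {xs : List A} → Unique xs →
                      (∀ x → g (f x) ≡ x) → (∀ x → f (g x) ≡ x) →
                      (∀ {x} → x ∈ xs → f x ∈ xs) → (∀ {x} → x ∈ xs → g x ∈ xs) →
                      (∀ {x} → x ∈ xs → w (f x) ≡ - w x) → sumℤ (map w xs) ≡ + 0
sumℤ-sign-reversing {f = f} w {xs} uniq g∘f≗id f∘g≗id f-closed g-closed reverses = i≡-i⇒i≡0 (begin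
  sumℤ (map w xs)             ≡⟨ sumℤ-↭ (PermP.map⁺ w f-permutes) ⟨
  sumℤ (map w (map f xs))     ≡⟨ cong sumℤ (map-∘ xs) ⟨
  sumℤ (map (w ∘ f) xs)       ≡⟨ cong sumℤ (map-cong-local (All.tabulate reverses)) ⟩
  sumℤ (map (-_ ∘ w) xs)      ≡⟨ cong sumℤ (map-∘ xs) ⟩
  sumℤ (map -_ (map w xs))    ≡⟨ sumℤ-neg (map w xs) ⟩
  - sumℤ (map w xs)           ∎)
  where
  open ≡-Reasoning
  f-permutes = map-↭-self uniq g∘f≗id f∘g≗id f-closed g-closed

negOnePow-even : ∀ {n} → 2 ∣ n → negOnePow n ≡ + 1
negOnePow-even (divides q refl) = go q
  where
  go : ∀ q → negOnePow (q * 2) ≡ + 1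
  go zero = refl
  go (suc q) = trans (ℤ.neg-involutive _) (go q)

<-suc-⇔ : ∀ {y k} → y ≢ k → (y < suc k) ⇔ (y < k)
<-suc-⇔ y≢k = mk⇔ (λ y<1+k → ≤∧≢⇒< (≤-pred y<1+k) y≢k) m<n⇒m<1+n

-- Transposing the values k and k + 1

transpose : ℕ → ℕ → ℕ
transpose k x with x ≟ k | x ≟ suc k
... | yes _ | _     = suc k
... | no _  | yes _ = k
... | no _  | no _  = x

transpose-k : ∀ k → transpose k k ≡ suc k
transpose-k k with k ≟ k
... | yes _  = refl
... | no k≢k = ⊥-elim (k≢k refl)

transpose-suc : ∀ k → transpose k (suc k) ≡ k
transpose-suc k with suc k ≟ k | suc k ≟ suc k
... | yes 1+k≡k | _   = ⊥-elim (1+n≢n 1+k≡k)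
... | no _  | yes _   = refl
... | no _  | no ne   = ⊥-elim (ne refl)

transpose-other : ∀ k {x} → x ≢ k → x ≢ suc k → transpose k x ≡ x
transpose-other k {x} x≢k x≢1+k with x ≟ k | x ≟ suc k
... | yes x≡k | _       = ⊥-elim (x≢k x≡k)
... | no _    | yes x≡1+k = ⊥-elim (x≢1+k x≡1+k)
... | no _    | no _    = refl

data TransposeCase (k : ℕ) : ℕ → Set where
  is-k     : TransposeCase k k
  is-suc-k : TransposeCase k (suc k)
  other    : ∀ {x} → x ≢ k → x ≢ suc k → TransposeCase k x

transposeCase : ∀ k x → TransposeCase k x
transposeCase k x with x ≟ k | x ≟ suc k
... | yes refl | _       = is-k
... | no _     | yes refl = is-suc-k
... | no x≢k   | no x≢1+k = other x≢k x≢1+k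

transpose-involutive : ∀ k x → transpose k (transpose k x) ≡ x
transpose-involutive k x with transposeCase k x
... | is-k = trans (cong (transpose k) (transpose-k k)) (transpose-suc k)
... | is-suc-k = trans (cong (transpose k) (transpose-suc k)) (transpose-k k)
... | other x≢k x≢1+k =
  trans (cong (transpose k) (transpose-other k x≢k x≢1+k)) (transpose-other k x≢k x≢1+k)

SwapPair : ℕ → ℕ × ℕ → Set
SwapPair k p = p ≡ (k , suc k) ⊎ p ≡ (suc k , k)

transpose-mono-< : ∀ k {x y} → ¬ SwapPair k (x , y) → x < y → transpose k x < transpose k y
transpose-mono-< k {x} {y} notSwap x<y with transposeCase k x | transposeCase k y
... | is-k | is-k = ⊥-elim (<-irrefl refl x<y)
... | is-k | is-suc-k = ⊥-elim (notSwap (inj₁ refl))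
... | is-k | other y≢k y≢1+k
  rewrite transpose-k k | transpose-other k y≢k y≢1+k = ≤∧≢⇒< x<y (y≢1+k ∘ sym)
... | is-suc-k | is-k = ⊥-elim (<-asym x<y (n<1+n k))
... | is-suc-k | is-suc-k = ⊥-elim (<-irrefl refl x<y)
... | is-suc-k | other y≢k y≢1+k
  rewrite transpose-suc k | transpose-other k y≢k y≢1+k = <-trans (n<1+n k) x<y
... | other x≢k x≢1+k | is-k
  rewrite transpose-other k x≢k x≢1+k | transpose-k k = m<n⇒m<1+n x<y
... | other x≢k x≢1+k | is-suc-k
  rewrite transpose-other k x≢k x≢1+k | transpose-suc k = ≤∧≢⇒< (≤-pred x<y) x≢k
... | other x≢k x≢1+k | other y≢k y≢1+k
  rewrite transpose-other k x≢k x≢1+k | transpose-other k y≢k y≢1+k = x<y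

SwapPair-sym : ∀ {k x y} → SwapPair k (x , y) → SwapPair k (y , x)
SwapPair-sym (inj₁ refl) = inj₂ refl
SwapPair-sym (inj₂ refl) = inj₁ refl

SwapPair-transpose : ∀ {k x y} → SwapPair k (x , y) → SwapPair k (transpose k x , transpose k y)
SwapPair-transpose {k} (inj₁ refl) = inj₂ (cong₂ _,_ (transpose-k k) (transpose-suc k))
SwapPair-transpose {k} (inj₂ refl) = inj₁ (cong₂ _,_ (transpose-suc k) (transpose-k k))

SwapPair-transpose⁻ : ∀ {k x y} → SwapPair k (transpose k x , transpose k y) → SwapPair k (x , y)
SwapPair-transpose⁻ {k} {x} {y} swap =
  subst (SwapPair k) (cong₂ _,_ (transpose-involutive k x) (transpose-involutive k y)) (SwapPair-transpose swap)

transpose-<-⇔ : ∀ k {x y} → ¬ SwapPair k (x , y) → (transpose k x < transpose k y) ⇔ (x < y)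
transpose-<-⇔ k {x} {y} notSwap = mk⇔ reflect (transpose-mono-< k notSwap)
  where
  reflect : transpose k x < transpose k y → x < y
  reflect τx<τy = subst₂ _<_ (transpose-involutive k x) (transpose-involutive k y)
    (transpose-mono-< k (notSwap ∘ SwapPair-transpose⁻) τx<τy)

∈-[1…n]⁻ : ∀ {n v} → v ∈ map suc (upTo n) → 1 ≤ v × v ≤ n
∈-[1…n]⁻ v∈ with ∈-map⁻ suc v∈
... | _ , u∈ , refl = s≤s z≤n , ∈-upTo⁻ u∈

∈-[1…n]⁺ : ∀ {n v} → 1 ≤ v → v ≤ n → v ∈ map suc (upTo n)
∈-[1…n]⁺ {v = suc u} _ v≤n = ∈-map⁺ suc (∈-upTo⁺ v≤n)

transpose-∈-[1…n] : ∀ {n k v} → 1 ≤ k → suc k ≤ n →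
                    v ∈ map suc (upTo n) → transpose k v ∈ map suc (upTo n)
transpose-∈-[1…n] {n} {k} {v} 1≤k 1+k≤n v∈ with transposeCase k v
... | is-k rewrite transpose-k k = ∈-[1…n]⁺ (s≤s z≤n) 1+k≤n
... | is-suc-k rewrite transpose-suc k = ∈-[1…n]⁺ 1≤k (≤-trans (n≤1+n k) 1+k≤n)
... | other v≢k v≢1+k rewrite transpose-other k v≢k v≢1+k = v∈

transpose-[1…n]-↭ : ∀ {n k} → 1 ≤ k → suc k ≤ n →
                    map (transpose k) (map suc (upTo n)) ↭ map suc (upTo n)
transpose-[1…n]-↭ {n} 1≤k 1+k≤n = map-↭-self (UniqueP.map⁺ suc-injective (UniqueP.upTo⁺ n))
  (transpose-involutive _) (transpose-involutive _)
  (transpose-∈-[1…n] 1≤k 1+k≤n) (transpose-∈-[1…n] 1≤k 1+k≤n)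

-- Inversions

smaller : ℕ → List ℕ → ℕ
smaller x ys = length (filter (_<? x) ys)

smaller-< : ∀ {x y} ys → y < x → smaller x (y ∷ ys) ≡ suc (smaller x ys)
smaller-< {x} ys y<x = cong length (filter-accept (_<? x) y<x)

smaller-≮ : ∀ {x y} ys → ¬ y < x → smaller x (y ∷ ys) ≡ smaller x ys
smaller-≮ {x} ys y≮x = cong length (filter-reject (_<? x) y≮x)

smaller-∷ : ∀ {a b x y} c xs ys → (x < a) ⇔ (y < b) → smaller a xs ≡ c + smaller b ys →
            smaller a (x ∷ xs) ≡ c + smaller b (y ∷ ys)
smaller-∷ {a} {b} {x} {y} c xs ys x<a⇔y<b eq with y <? b
... | yes y<b = begin
  smaller a (x ∷ xs)         ≡⟨ smaller-< xs (Equivalence.from x<a⇔y<b y<b) ⟩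
  suc (smaller a xs)         ≡⟨ cong suc eq ⟩
  suc (c + smaller b ys)     ≡⟨ +-suc c (smaller b ys) ⟨
  c + suc (smaller b ys)     ≡⟨ cong (_+_ c) (smaller-< ys y<b) ⟨
  c + smaller b (y ∷ ys)     ∎
  where open ≡-Reasoning
... | no y≮b = begin
  smaller a (x ∷ xs)         ≡⟨ smaller-≮ xs (y≮b ∘ Equivalence.to x<a⇔y<b) ⟩
  smaller a xs               ≡⟨ eq ⟩
  c + smaller b ys           ≡⟨ cong (_+_ c) (smaller-≮ ys y≮b) ⟨
  c + smaller b (y ∷ ys)     ∎
  where open ≡-Reasoning

smaller-map-cong : ∀ {f g : ℕ → ℕ} {a b} ys → All (λ y → (f y < a) ⇔ (g y < b)) ys →
                   smaller a (map f ys) ≡ smaller b (map g ys)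
smaller-map-cong [] [] = refl
smaller-map-cong {f} {g} (y ∷ ys) (agree ∷ rest) =
  smaller-∷ 0 (map f ys) (map g ys) agree (smaller-map-cong ys rest)

smaller-map-suc : ∀ {f g : ℕ → ℕ} {a b v} ys → Unique ys → v ∈ ys → f v < a → ¬ g v < b →
                  All (λ y → y ≢ v → (f y < a) ⇔ (g y < b)) ys →
                  smaller a (map f ys) ≡ suc (smaller b (map g ys))
smaller-map-suc {f} {g} {a} {b} (v ∷ ys) (v∉ys ∷ _) (here refl) fv<a gv≮b (_ ∷ rest) = begin
  smaller a (f v ∷ map f ys)        ≡⟨ smaller-< (map f ys) fv<a ⟩
  suc (smaller a (map f ys))        ≡⟨ cong suc (smaller-map-cong ys agree-on-ys) ⟩
  suc (smaller b (map g ys))        ≡⟨ cong suc (smaller-≮ (map g ys) gv≮b) ⟨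
  suc (smaller b (g v ∷ map g ys))  ∎
  where
  open ≡-Reasoning
  agree-on-ys = All.zipWith (λ (v≢y , agree) → agree (v≢y ∘ sym)) (v∉ys , rest)
smaller-map-suc {f} {g} (y ∷ ys) (y∉ys ∷ uniq) (there v∈ys) fv<a gv≮b (agree ∷ rest) =
  smaller-∷ 1 (map f ys) (map g ys) (agree (All.lookup y∉ys v∈ys))
    (smaller-map-suc ys uniq v∈ys fv<a gv≮b rest)

NoSwapPair : ℕ → List ℕ → Set
NoSwapPair k = AllPairs (λ x y → ¬ SwapPair k (x , y))

NoSwapPair-∉ : ∀ {k} w → k ∉ w ⊎ suc k ∉ w → NoSwapPair k w
NoSwapPair-∉ [] _ = []
NoSwapPair-∉ {k} (x ∷ xs) missing =
  All.tabulate (λ y∈xs swap → absurd (here refl) (there y∈xs) swap)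
  ∷ NoSwapPair-∉ xs (Sum.map (_∘ there) (_∘ there) missing)
  where
  absurd : ∀ {y} → x ∈ x ∷ xs → y ∈ x ∷ xs → ¬ SwapPair k (x , y)
  absurd x∈ y∈ (inj₁ refl) = Sum.[ (λ k∉ → k∉ x∈) , (λ 1+k∉ → 1+k∉ y∈) ] missing
  absurd x∈ y∈ (inj₂ refl) = Sum.[ (λ k∉ → k∉ y∈) , (λ 1+k∉ → 1+k∉ x∈) ] missing

smaller-transpose : ∀ k {x} ys → All (λ y → ¬ SwapPair k (x , y)) ys →
                    smaller (transpose k x) (map (transpose k) ys) ≡ smaller x ys
smaller-transpose k {x} ys noSwap =
  trans (smaller-map-cong ys (All.map (transpose-<-⇔ k ∘ (_∘ SwapPair-sym)) noSwap))
        (cong (smaller x) (map-id ys))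

inv-transpose-NoSwapPair : ∀ k w → NoSwapPair k w → inv (map (transpose k) w) ≡ inv w
inv-transpose-NoSwapPair k [] [] = refl
inv-transpose-NoSwapPair k (x ∷ xs) (noSwap ∷ noSwaps) =
  cong₂ _+_ (smaller-transpose k xs noSwap) (inv-transpose-NoSwapPair k xs noSwaps)

smaller-transpose-k : ∀ k ys → Unique ys → All (k ≢_) ys → suc k ∈ ys →
                      smaller (suc k) (map (transpose k) ys) ≡ suc (smaller k ys)
smaller-transpose-k k ys uniq k∉ys 1+k∈ys = begin
  smaller (suc k) (map (transpose k) ys)
    ≡⟨ smaller-map-suc ys uniq 1+k∈ys τ[1+k]<1+k (<-asym (n<1+n k)) agree ⟩
  suc (smaller k (map id ys))            ≡⟨ cong (suc ∘ smaller k) (map-id ys) ⟩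
  suc (smaller k ys)                      ∎
  where
  open ≡-Reasoning
  τ[1+k]<1+k : transpose k (suc k) < suc k
  τ[1+k]<1+k = subst (_< suc k) (sym (transpose-suc k)) (n<1+n k)
  agree : All (λ y → y ≢ suc k → (transpose k y < suc k) ⇔ (id y < k)) ys
  agree = All.map (λ {y} k≢y y≢1+k →
    subst (λ t → (t < suc k) ⇔ (y < k)) (sym (transpose-other k (k≢y ∘ sym) y≢1+k))
          (<-suc-⇔ (k≢y ∘ sym))) k∉ys

smaller-transpose-suc-k : ∀ k ys → Unique ys → All (suc k ≢_) ys → k ∈ ys →
                          smaller (suc k) ys ≡ suc (smaller k (map (transpose k) ys))
smaller-transpose-suc-k k ys uniq 1+k∉ys k∈ys = begin
  smaller (suc k) ys             ≡⟨ cong (smaller (suc k)) (map-id ys) ⟨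
  smaller (suc k) (map id ys)    ≡⟨ smaller-map-suc ys uniq k∈ys (n<1+n k) τk≮k agree ⟩
  suc (smaller k (map (transpose k) ys)) ∎
  where
  open ≡-Reasoning
  τk≮k : ¬ transpose k k < k
  τk≮k = subst (λ t → ¬ t < k) (sym (transpose-k k)) (<-asym (n<1+n k))
  agree : All (λ y → y ≢ k → (id y < suc k) ⇔ (transpose k y < k)) ys
  agree = All.map (λ {y} 1+k≢y y≢k →
    subst (λ t → (y < suc k) ⇔ (t < k)) (sym (transpose-other k y≢k (1+k≢y ∘ sym)))
          (<-suc-⇔ y≢k)) 1+k∉ys

-- Only the relative order of k and k + 1 changes.
inv-transpose : ∀ k w → Unique w → k ∈ w → suc k ∈ w →
                inv (map (transpose k) w) ≡ suc (inv w) ⊎ suc (inv (map (transpose k) w)) ≡ inv w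
inv-transpose k (x ∷ xs) uniqW@(x∉xs ∷ uniq) k∈w 1+k∈w with transposeCase k x
... | is-k = inj₁ (cong₂ _+_
  (trans (cong (λ t → smaller t (map (transpose k) xs)) (transpose-k k))
         (smaller-transpose-k k xs uniq x∉xs (Any.tail 1+n≢n 1+k∈w)))
  (inv-transpose-NoSwapPair k xs (NoSwapPair-∉ xs (inj₁ (Unique[x∷xs]⇒x∉xs uniqW)))))
... | is-suc-k = inj₂ (cong₂ _+_
  (trans (cong (λ t → suc (smaller t (map (transpose k) xs))) (transpose-suc k))
         (sym (smaller-transpose-suc-k k xs uniq x∉xs (Any.tail (1+n≢n ∘ sym) k∈w))))
  (inv-transpose-NoSwapPair k xs (NoSwapPair-∉ xs (inj₂ (Unique[x∷xs]⇒x∉xs uniqW)))))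
... | other x≢k x≢1+k =
  Sum.map (λ eq → trans (cong₂ _+_ smaller-eq eq) (+-suc (smaller x xs) (inv xs)))
               (λ eq → trans (sym (+-suc _ _)) (cong₂ _+_ smaller-eq eq))
               (inv-transpose k xs uniq (Any.tail (x≢k ∘ sym) k∈w) (Any.tail (x≢1+k ∘ sym) 1+k∈w))
  where
  notSwap : ∀ {y} → ¬ SwapPair k (x , y)
  notSwap (inj₁ refl) = x≢k refl
  notSwap (inj₂ refl) = x≢1+k refl
  smaller-eq : smaller (transpose k x) (map (transpose k) xs) ≡ smaller x xs
  smaller-eq = smaller-transpose k xs (All.tabulate λ _ → notSwap)

negOnePow-transpose : ∀ k w → Unique w → k ∈ w → suc k ∈ w →
                      negOnePow (inv (map (transpose k) w)) ≡ - negOnePow (inv w)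
negOnePow-transpose k w uniq k∈w 1+k∈w with inv-transpose k w uniq k∈w 1+k∈w
... | inj₁ eq = cong negOnePow eq
... | inj₂ eq = trans (sym (ℤ.neg-involutive _)) (cong (-_ ∘ negOnePow) eq)

-- Cells of a filling

infix 4 _[_]=_ _[_][_]=_

data _[_]=_ : List ℕ → ℕ → ℕ → Set where
  first : ∀ {v r} → v ∷ r [ 0 ]= v
  later : ∀ {x r j v} → r [ j ]= v → x ∷ r [ suc j ]= v

data _[_][_]=_ : Filling → ℕ → ℕ → ℕ → Set where
  top   : ∀ {r T j v} → r [ j ]= v → r ∷ T [ 0 ][ j ]= v
  below : ∀ {r T i j v} → T [ i ][ j ]= v → r ∷ T [ suc i ][ j ]= v

entry-∈ : ∀ {r j v} → r [ j ]= v → v ∈ r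
entry-∈ first = here refl
entry-∈ (later at) = there (entry-∈ at)

cell-∈ : ∀ {T i j v} → T [ i ][ j ]= v → v ∈ concat T
cell-∈ (top at) = AnyP.++⁺ˡ (entry-∈ at)
cell-∈ {r ∷ _} (below at) = AnyP.++⁺ʳ r (cell-∈ at)

∈-entry : ∀ {r v} → v ∈ r → ∃ λ j → r [ j ]= v
∈-entry (here refl) = 0 , first
∈-entry (there v∈r) = Product.map suc later (∈-entry v∈r)

∈-cell : ∀ T {v} → v ∈ concat T → ∃₂ λ i j → T [ i ][ j ]= v
∈-cell (r ∷ T) v∈ with AnyP.++⁻ r v∈
... | inj₁ v∈r = let j , at = ∈-entry v∈r in 0 , j , top at
... | inj₂ v∈T = let i , j , at = ∈-cell T v∈T in suc i , j , below at

entry-map : ∀ (f : ℕ → ℕ) {r j v} → r [ j ]= v → map f r [ j ]= f v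
entry-map f first = first
entry-map f (later at) = later (entry-map f at)

cell-map : ∀ (f : ℕ → ℕ) {T i j v} → T [ i ][ j ]= v → map (map f) T [ i ][ j ]= f v
cell-map f (top at) = top (entry-map f at)
cell-map f (below at) = below (cell-map f at)

entry-unique : ∀ {r j j' v} → Unique r → r [ j ]= v → r [ j' ]= v → j ≡ j'
entry-unique _ first first = refl
entry-unique (v∉r ∷ _) first (later at) = ⊥-elim (All.lookup v∉r (entry-∈ at) refl)
entry-unique (v∉r ∷ _) (later at) first = ⊥-elim (All.lookup v∉r (entry-∈ at) refl)
entry-unique (_ ∷ uniq) (later at) (later at') = cong suc (entry-unique uniq at at')

cell-unique : ∀ {T i j i' j' v} → Unique (concat T) → T [ i ][ j ]= v → T [ i' ][ j' ]= v →
              i ≡ i' × j ≡ j'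
cell-unique {r ∷ T} uniq at at' with Unique-++⁻ r uniq | at | at'
... | uniqr , _ , _ | top e | top e' = refl , entry-unique uniqr e e'
... | _ , _ , disjoint | top e | below c = ⊥-elim (disjoint (entry-∈ e , cell-∈ c))
... | _ , _ , disjoint | below c | top e = ⊥-elim (disjoint (entry-∈ e , cell-∈ c))
... | _ , uniqT , _ | below c | below c' = Product.map₁ (cong suc) (cell-unique uniqT c c')

entry-index< : ∀ {r j v} → r [ j ]= v → j < length r
entry-index< first = s≤s z≤n
entry-index< (later at) = s≤s (entry-index< at)

entry-exists : ∀ {r j} → j < length r → ∃ λ w → r [ j ]= w
entry-exists {x ∷ r} {zero} _ = x , first
entry-exists {x ∷ r} {suc j} (s≤s j<len) = Product.map₂ later (entry-exists j<len)

entry-right : ∀ {r j u w} → Linked _<_ r → r [ j ]= u → r [ suc j ]= w → u < w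
entry-right (u<w ∷ _) first (later first) = u<w
entry-right (_ ∷ increasing) (later at) (later at') = entry-right increasing at at'

cell-right : ∀ {T i j u w} → All (Linked _<_) T → T [ i ][ j ]= u → T [ i ][ suc j ]= w → u < w
cell-right (increasing ∷ _) (top at) (top at') = entry-right increasing at at'
cell-right (_ ∷ rows) (below c) (below c') = cell-right rows c c'

entry-left : ∀ {r j v} → Linked _<_ r → r [ suc j ]= v → ∃ λ u → r [ j ]= u × u < v
entry-left (u<v ∷ _) (later first) = _ , first , u<v
entry-left (_ ∷ increasing) (later (later at)) =
  let u , u-at , u<v = entry-left increasing (later at) in u , later u-at , u<v

cell-left : ∀ {T i j v} → All (Linked _<_) T → T [ i ][ suc j ]= v → ∃ λ u → T [ i ][ j ]= u × u < v
cell-left (increasing ∷ _) (top at) = let u , u-at , u<v = entry-left increasing at in u , top u-at , u<v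
cell-left (_ ∷ rows) (below c) = let u , u-at , u<v = cell-left rows c in u , below u-at , u<v

entry-below : ∀ {r r' j u w} → ColInc r r' → r [ j ]= u → r' [ j ]= w → u < w
entry-below (u<w ∷ _) first first = u<w
entry-below (_ ∷ increasing) (later at) (later at') = entry-below increasing at at'

cell-below : ∀ {T i j u w} → Linked ColInc T → T [ i ][ j ]= u → T [ suc i ][ j ]= w → u < w
cell-below (increasing ∷ _) (top at) (below (top at')) = entry-below increasing at at'
cell-below (_ ∷ columns) (below c) (below c') = cell-below columns c c'

entry-above : ∀ {r r' j v} → ColInc r r' → length r' ≤ length r → r' [ j ]= v → ∃ λ u → r [ j ]= u × u < v
entry-above {r} {r'} {j} increasing len≤ v-at =
  let u , u-at = entry-exists (<-≤-trans (entry-index< v-at) len≤)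
  in u , u-at , entry-below increasing u-at v-at

cell-above : ∀ {T i j v} → Linked ColInc T → Linked (λ r r' → length r' ≤ length r) T →
             T [ suc i ][ j ]= v → ∃ λ u → T [ i ][ j ]= u × u < v
cell-above (increasing ∷ _) (len≤ ∷ _) (below (top at)) =
  let u , u-at , u<v = entry-above increasing len≤ at in u , top u-at , u<v
cell-above (_ ∷ columns) (_ ∷ lengths) (below (below c)) =
  let u , u-at , u<v = cell-above columns lengths (below c) in u , below u-at , u<v

colour : ℕ → ℕ → ℤ
colour i j = negOnePow (i + j)

horizontalPairs : List ℕ → List (ℕ × ℕ)
horizontalPairs (x ∷ y ∷ r) = (x , y) ∷ horizontalPairs (y ∷ r)
horizontalPairs _ = []

verticalPairs : List ℕ → Filling → List (ℕ × ℕ)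
verticalPairs r [] = []
verticalPairs r (r' ∷ _) = zip r r'

neighbourPairs : Filling → List (ℕ × ℕ)
neighbourPairs [] = []
neighbourPairs (r ∷ T) = horizontalPairs r ++ verticalPairs r T ++ neighbourPairs T

horizontalPairs-map : ∀ f r → horizontalPairs (map f r) ≡ map (Product.map f f) (horizontalPairs r)
horizontalPairs-map f [] = refl
horizontalPairs-map f (x ∷ []) = refl
horizontalPairs-map f (x ∷ y ∷ r) = cong (_ ∷_) (horizontalPairs-map f (y ∷ r))

verticalPairs-map : ∀ f r T →
                    verticalPairs (map f r) (map (map f) T) ≡ map (Product.map f f) (verticalPairs r T)
verticalPairs-map f r [] = refl
verticalPairs-map f r (r' ∷ _) = zip-map f f r r'

neighbourPairs-map : ∀ f T → neighbourPairs (map (map f) T) ≡ map (Product.map f f) (neighbourPairs T)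
neighbourPairs-map f [] = refl
neighbourPairs-map f (r ∷ T) = begin
  horizontalPairs (map f r) ++ verticalPairs (map f r) (map (map f) T) ++ neighbourPairs (map (map f) T)
    ≡⟨ cong₂ _++_ (horizontalPairs-map f r)
                  (cong₂ _++_ (verticalPairs-map f r T) (neighbourPairs-map f T)) ⟩
  map f² (horizontalPairs r) ++ map f² (verticalPairs r T) ++ map f² (neighbourPairs T)
    ≡⟨ cong (map f² (horizontalPairs r) ++_) (map-++ f² (verticalPairs r T) (neighbourPairs T)) ⟨
  map f² (horizontalPairs r) ++ map f² (verticalPairs r T ++ neighbourPairs T)
    ≡⟨ map-++ f² (horizontalPairs r) _ ⟨
  map f² (neighbourPairs (r ∷ T)) ∎
  where open ≡-Reasoning
        f² = Product.map f f

horizontalPairs-entries : ∀ {x y} r → (x , y) ∈ horizontalPairs r → ∃ λ j → r [ j ]= x × r [ suc j ]= y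
horizontalPairs-entries (x ∷ y ∷ r) (here refl) = 0 , first , later first
horizontalPairs-entries (_ ∷ y ∷ r) (there p∈) =
  let j , x-at , y-at = horizontalPairs-entries (y ∷ r) p∈ in suc j , later x-at , later y-at

zip-entries : ∀ {x y} r r' → (x , y) ∈ zip r r' → ∃ λ j → r [ j ]= x × r' [ j ]= y
zip-entries (x ∷ r) (y ∷ r') (here refl) = 0 , first , first
zip-entries (_ ∷ r) (_ ∷ r') (there p∈) =
  let j , x-at , y-at = zip-entries r r' p∈ in suc j , later x-at , later y-at

verticalPairs-cells : ∀ {x y} r T → (x , y) ∈ verticalPairs r T →
                      ∃ λ j → r ∷ T [ 0 ][ j ]= x × r ∷ T [ 1 ][ j ]= y
verticalPairs-cells r (r' ∷ _) p∈ =
  let j , x-at , y-at = zip-entries r r' p∈ in j , top x-at , below (top y-at)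

neighbourPairs-cells : ∀ {x y} T → (x , y) ∈ neighbourPairs T →
  ∃₂ λ i j → ∃₂ λ i' j' → T [ i ][ j ]= x × T [ i' ][ j' ]= y × colour i' j' ≡ - colour i j
neighbourPairs-cells (r ∷ T) p∈ with AnyP.++⁻ (horizontalPairs r) p∈
... | inj₁ p∈h = let j , x-at , y-at = horizontalPairs-entries r p∈h
  in 0 , j , 0 , suc j , top x-at , top y-at , refl
... | inj₂ p∈vn with AnyP.++⁻ (verticalPairs r T) p∈vn
...   | inj₁ p∈v = let j , x-at , y-at = verticalPairs-cells r T p∈v
  in 0 , j , 1 , j , x-at , y-at , refl
...   | inj₂ p∈n = let i , j , i' , j' , x-at , y-at , opposite = neighbourPairs-cells T p∈n
  in suc i , j , suc i' , j' , below x-at , below y-at , cong -_ opposite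

-- Swapping k and k + 1 unless they are adjacent

Adjacent : ℕ → Filling → Set
Adjacent k T = Any (SwapPair k) (neighbourPairs T)

adjacent? : ∀ k T → Dec (Adjacent k T)
adjacent? k T = Any.any? swapPair? (neighbourPairs T)
  where swapPair? = λ p → ≡-dec _≟_ _≟_ p (k , suc k) ⊎-dec ≡-dec _≟_ _≟_ p (suc k , k)

swapValues : ℕ → Filling → Filling
swapValues k = map (map (transpose k))

swapIfApart : ℕ → Filling → Filling
swapIfApart k T with adjacent? k T
... | yes _ = T
... | no _  = swapValues k T

swapIfApart-adjacent : ∀ {k T} → Adjacent k T → swapIfApart k T ≡ T
swapIfApart-adjacent {k} {T} adj with adjacent? k T
... | yes _ = refl
... | no ¬adj = ⊥-elim (¬adj adj)

swapIfApart-apart : ∀ {k T} → ¬ Adjacent k T → swapIfApart k T ≡ swapValues k T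
swapIfApart-apart {k} {T} ¬adj with adjacent? k T
... | yes adj = ⊥-elim (¬adj adj)
... | no _ = refl

swapValues-involutive : ∀ k T → swapValues k (swapValues k T) ≡ T
swapValues-involutive k = map-involutive (map-involutive (transpose-involutive k))

Adjacent-swapValues : ∀ {k} T → Adjacent k (swapValues k T) → Adjacent k T
Adjacent-swapValues {k} T adj =
  Any.map SwapPair-transpose⁻
          (AnyP.map⁻ (subst (Any (SwapPair k)) (neighbourPairs-map (transpose k) T) adj))

swapIfApart-involutive : ∀ k T → swapIfApart k (swapIfApart k T) ≡ T
swapIfApart-involutive k T = by-cases (adjacent? k T)
  where
  by-cases : Dec (Adjacent k T) → swapIfApart k (swapIfApart k T) ≡ T
  by-cases (yes adj) =
    trans (cong (swapIfApart k) (swapIfApart-adjacent {k} {T} adj)) (swapIfApart-adjacent {k} {T} adj)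
  by-cases (no ¬adj) = begin
    swapIfApart k (swapIfApart k T)  ≡⟨ cong (swapIfApart k) (swapIfApart-apart {k} {T} ¬adj) ⟩
    swapIfApart k (swapValues k T)   ≡⟨ swapIfApart-apart {k} {swapValues k T} (¬adj ∘ Adjacent-swapValues T) ⟩
    swapValues k (swapValues k T)    ≡⟨ swapValues-involutive k T ⟩
    T                                ∎
    where open ≡-Reasoning

transpose-row-increasing : ∀ k r → ¬ Any (SwapPair k) (horizontalPairs r) →
                           Linked _<_ r → Linked _<_ (map (transpose k) r)
transpose-row-increasing k [] _ [] = []
transpose-row-increasing k (x ∷ []) _ [-] = [-]
transpose-row-increasing k (x ∷ y ∷ r) noSwap (x<y ∷ increasing) =
  transpose-mono-< k (noSwap ∘ here) x<y ∷ transpose-row-increasing k (y ∷ r) (noSwap ∘ there) increasing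

transpose-ColInc : ∀ k r r' → ¬ Any (SwapPair k) (zip r r') → ColInc r r' →
                   ColInc (map (transpose k) r) (map (transpose k) r')
transpose-ColInc k r r' noSwap increasing
  rewrite zip-map (transpose k) (transpose k) r r' =
  AllP.map⁺ (All.zipWith (λ (¬swap , x<y) → transpose-mono-< k ¬swap x<y)
                         (AllP.¬Any⇒All¬ (zip r r') noSwap , increasing))

swapValues-rows : ∀ k T → ¬ Adjacent k T → All (Linked _<_) T → All (Linked _<_) (swapValues k T)
swapValues-rows k [] _ [] = []
swapValues-rows k (r ∷ T) ¬adj (increasing ∷ rows) =
  transpose-row-increasing k r (¬adj ∘ AnyP.++⁺ˡ) increasing
  ∷ swapValues-rows k T (¬adj ∘ AnyP.++⁺ʳ (horizontalPairs r) ∘ AnyP.++⁺ʳ (verticalPairs r T)) rows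

swapValues-columns : ∀ k T → ¬ Adjacent k T → Linked ColInc T → Linked ColInc (swapValues k T)
swapValues-columns k [] _ [] = []
swapValues-columns k (r ∷ []) _ [-] = [-]
swapValues-columns k (r ∷ r' ∷ T) ¬adj (increasing ∷ columns) =
  transpose-ColInc k r r' (¬adj ∘ AnyP.++⁺ʳ (horizontalPairs r) ∘ AnyP.++⁺ˡ) increasing
  ∷ swapValues-columns k (r' ∷ T) (¬adj ∘ AnyP.++⁺ʳ (horizontalPairs r) ∘ AnyP.++⁺ʳ (zip r r')) columns

swapValues-SYT : ∀ {D T k} → 1 ≤ k → suc k ≤ size D → ¬ Adjacent k T →
                 IsSYT D T → IsSYT D (swapValues k T)
swapValues-SYT {D} {T} {k} 1≤k 1+k≤n ¬adj (shape , entries , rows , columns) =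
  trans (trans (sym (map-∘ T)) (map-cong (length-map (transpose k)) T)) shape ,
  subst (_↭ map suc (upTo (size D))) (sym (concat-map T))
        (↭-trans (PermP.map⁺ (transpose k) entries) (transpose-[1…n]-↭ 1≤k 1+k≤n)) ,
  swapValues-rows k T ¬adj rows ,
  swapValues-columns k T ¬adj columns

swapIfApart-SYT : ∀ {D T k} → 1 ≤ k → suc k ≤ size D → IsSYT D T → IsSYT D (swapIfApart k T)
swapIfApart-SYT {D} {T} {k} 1≤k 1+k≤n syt with adjacent? k T
... | yes _ = syt
... | no ¬adj = swapValues-SYT 1≤k 1+k≤n ¬adj syt

sgn-swapValues : ∀ k T → Unique (concat T) → k ∈ concat T → suc k ∈ concat T →
                 sgn (swapValues k T) ≡ - sgn T
sgn-swapValues k T uniq k∈ 1+k∈ = begin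
  negOnePow (inv (concat (map (map (transpose k)) T)))   ≡⟨ cong (negOnePow ∘ inv) (concat-map T) ⟩
  negOnePow (inv (map (transpose k) (concat T)))          ≡⟨ negOnePow-transpose k (concat T) uniq k∈ 1+k∈ ⟩
  - negOnePow (inv (concat T))                            ∎
  where open ≡-Reasoning

SignedColour : Filling → ℕ → ℤ → Set
SignedColour T v z = ∃₂ λ i j → T [ i ][ j ]= v × z ≡ sgn T *ℤ colour i j

swapIfApart-SignedColour : ∀ {T k z} → Unique (concat T) → suc k ∈ concat T →
                           SignedColour T k z → SignedColour (swapIfApart k T) (suc k) (- z)
swapIfApart-SignedColour {T} {k} {z} uniq 1+k∈ (i , j , k-at , z≡) with adjacent? k T
... | no ¬adj =
  i , j , subst (swapValues k T [ i ][ j ]=_) (transpose-k k) (cell-map (transpose k) k-at) , (begin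
  - z                              ≡⟨ cong -_ z≡ ⟩
  - (sgn T *ℤ colour i j)          ≡⟨ ℤ.neg-distribˡ-* (sgn T) (colour i j) ⟩
  - sgn T *ℤ colour i j            ≡⟨ cong (_*ℤ colour i j) (sgn-swapValues k T uniq (cell-∈ k-at) 1+k∈) ⟨
  sgn (swapValues k T) *ℤ colour i j ∎)
  where open ≡-Reasoning
... | yes adj with find adj
...   | (x , y) , p∈ , swap with neighbourPairs-cells T p∈ | swap
...     | i₁ , j₁ , i₂ , j₂ , x-at , y-at , opposite | inj₁ refl
  with refl , refl ← cell-unique uniq k-at x-at = i₂ , j₂ , y-at , (begin
  - z                              ≡⟨ cong -_ z≡ ⟩
  - (sgn T *ℤ colour i j)          ≡⟨ ℤ.neg-distribʳ-* (sgn T) (colour i j) ⟩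
  sgn T *ℤ - colour i j            ≡⟨ cong (sgn T *ℤ_) opposite ⟨
  sgn T *ℤ colour i₂ j₂            ∎)
  where open ≡-Reasoning
...     | i₁ , j₁ , i₂ , j₂ , x-at , y-at , opposite | inj₂ refl
  with refl , refl ← cell-unique uniq k-at y-at = i₁ , j₁ , x-at , (begin
  - z                              ≡⟨ cong -_ z≡ ⟩
  - (sgn T *ℤ colour i j)          ≡⟨ ℤ.neg-distribʳ-* (sgn T) (colour i j) ⟩
  sgn T *ℤ - colour i j            ≡⟨ cong (λ c → sgn T *ℤ - c) opposite ⟩
  sgn T *ℤ - - colour i₁ j₁        ≡⟨ cong (sgn T *ℤ_) (ℤ.neg-involutive (colour i₁ j₁)) ⟩
  sgn T *ℤ colour i₁ j₁            ∎)
  where open ≡-Reasoning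

-- Promotion

SYT-unique : ∀ {D T} → IsSYT D T → Unique (concat T)
SYT-unique {D} (_ , entries , _) =
  PermS.Unique-resp-↭ (↭⇒↭ₛ (↭-sym entries)) (UniqueP.map⁺ suc-injective (UniqueP.upTo⁺ (size D)))

SYT-∈ : ∀ {D T v} → IsSYT D T → 1 ≤ v → v ≤ size D → v ∈ concat T
SYT-∈ (_ , entries , _) 1≤v v≤n = PermP.∈-resp-↭ (↭-sym entries) (∈-[1…n]⁺ 1≤v v≤n)

SYT-entry-bounds : ∀ {D T i j v} → IsSYT D T → T [ i ][ j ]= v → 1 ≤ v × v ≤ size D
SYT-entry-bounds (_ , entries , _) v-at = ∈-[1…n]⁻ (PermP.∈-resp-↭ entries (cell-∈ v-at))

-- sweep k m = s_{k+m-1} ∘ ⋯ ∘ s_k.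
sweep : ℕ → ℕ → Filling → Filling
sweep k zero T = T
sweep k (suc m) T = sweep (suc k) m (swapIfApart k T)

unsweep : ℕ → ℕ → Filling → Filling
unsweep k zero T = T
unsweep k (suc m) T = swapIfApart k (unsweep (suc k) m T)

unsweep-sweep : ∀ k m T → unsweep k m (sweep k m T) ≡ T
unsweep-sweep k zero T = refl
unsweep-sweep k (suc m) T =
  trans (cong (swapIfApart k) (unsweep-sweep (suc k) m (swapIfApart k T))) (swapIfApart-involutive k T)

sweep-unsweep : ∀ k m T → sweep k m (unsweep k m T) ≡ T
sweep-unsweep k zero T = refl
sweep-unsweep k (suc m) T =
  trans (cong (sweep (suc k) m) (swapIfApart-involutive k (unsweep (suc k) m T))) (sweep-unsweep (suc k) m T)

sweep-bounds : ∀ {k m n} → k + suc m ≤ n → suc k ≤ n × suc k + m ≤ n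
sweep-bounds {k} {m} {n} k+1+m≤n = ≤-trans (s≤s (m≤m+n k m)) 1+k+m≤n , 1+k+m≤n
  where 1+k+m≤n = subst (_≤ n) (+-suc k m) k+1+m≤n

sweep-SYT : ∀ {D} k m {T} → 1 ≤ k → k + m ≤ size D → IsSYT D T → IsSYT D (sweep k m T)
sweep-SYT k zero _ _ syt = syt
sweep-SYT k (suc m) 1≤k bound syt =
  let 1+k≤n , 1+k+m≤n = sweep-bounds bound
  in sweep-SYT (suc k) m (s≤s z≤n) 1+k+m≤n (swapIfApart-SYT 1≤k 1+k≤n syt)

unsweep-SYT : ∀ {D} k m {T} → 1 ≤ k → k + m ≤ size D → IsSYT D T → IsSYT D (unsweep k m T)
unsweep-SYT k zero _ _ syt = syt
unsweep-SYT k (suc m) 1≤k bound syt =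
  let 1+k≤n , 1+k+m≤n = sweep-bounds bound
  in swapIfApart-SYT 1≤k 1+k≤n (unsweep-SYT (suc k) m (s≤s z≤n) 1+k+m≤n syt)

sweep-SignedColour : ∀ {D} k m {T z} → 1 ≤ k → k + m ≤ size D → IsSYT D T →
                     SignedColour T k z → SignedColour (sweep k m T) (k + m) (negOnePow m *ℤ z)
sweep-SignedColour k zero {T} {z} _ _ _ k-colour =
  subst₂ (SignedColour T) (sym (+-identityʳ k)) (sym (ℤ.*-identityˡ z)) k-colour
sweep-SignedColour {D} k (suc m) {T} {z} 1≤k bound syt k-colour =
  subst₂ (SignedColour (sweep k (suc m) T)) (sym (+-suc k m)) (begin
      negOnePow m *ℤ - z        ≡⟨ ℤ.neg-distribʳ-* (negOnePow m) z ⟨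
      - (negOnePow m *ℤ z)      ≡⟨ ℤ.neg-distribˡ-* (negOnePow m) z ⟩
      negOnePow (suc m) *ℤ z    ∎)
    (sweep-SignedColour (suc k) m (s≤s z≤n) 1+k+m≤n (swapIfApart-SYT 1≤k 1+k≤n syt)
      (swapIfApart-SignedColour (SYT-unique syt) (SYT-∈ syt (s≤s z≤n) 1+k≤n) k-colour))
  where
  open ≡-Reasoning
  1+k≤n = proj₁ (sweep-bounds bound)
  1+k+m≤n = proj₂ (sweep-bounds bound)

-- Corners of fourling shapes

shape-size-positive : ∀ {D} → IsShape D → D ≢ [] → 1 ≤ size D
shape-size-positive {[]} _ D≢[] = ⊥-elim (D≢[] refl)
shape-size-positive {a ∷ D} (0<a ∷ _ , _) _ = ≤-trans 0<a (m≤m+n a (size D))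

SYT-first-cell : ∀ {D T} → IsShape D → 1 ≤ size D → IsSYT D T → T [ 0 ][ 0 ]= 1
SYT-first-cell {D} {T} (_ , decreasing) 1≤n syt@(shape , _ , rows , columns)
  with ∈-cell T (SYT-∈ syt ≤-refl 1≤n)
... | zero , zero , at = at
... | _ , suc j , at =
  let _ , u-at , u<1 = cell-left rows at in ⊥-elim (≤⇒≯ (proj₁ (SYT-entry-bounds syt u-at)) u<1)
... | suc i , zero , at =
  let _ , u-at , u<1 = cell-above columns (LinkedP.map⁻ (subst (Linked _≥_) (sym shape) decreasing)) at
  in ⊥-elim (≤⇒≯ (proj₁ (SYT-entry-bounds syt u-at)) u<1)

fourling-size-even : ∀ {D} → IsFourling D → 2 ∣ size D
fourling-size-even fl-nil = 2 ∣0
fourling-size-even (fl-cons refl 2∣a rest) = ∣m∣n⇒∣m+n 2∣a (∣m∣n⇒∣m+n 2∣a (fourling-size-even rest))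

fourling-corner-colour : ∀ T {i j v} → IsFourling (map length T) → T [ i ][ j ]= v →
                         (∀ {w} → ¬ T [ i ][ suc j ]= w) → (∀ {w} → ¬ T [ suc i ][ j ]= w) →
                         colour i j ≡ + 1
fourling-corner-colour (r ∷ r' ∷ T) (fl-cons same-length _ _) (top at) _ nothing-below =
  ⊥-elim (nothing-below (below (top (proj₂ (entry-exists (subst (_ <_) same-length (entry-index< at)))))))
fourling-corner-colour (r ∷ r' ∷ T) {j = j} (fl-cons same-length 2∣len _) (below (top at)) nothing-right _
  with suc j <? length r'
... | yes 1+j<len = ⊥-elim (nothing-right (below (top (proj₂ (entry-exists 1+j<len)))))
... | no 1+j≮len = negOnePow-even (subst (2 ∣_) len≡1+j 2∣len)
  where len≡1+j = trans same-length (≤-antisym (≮⇒≥ 1+j≮len) (entry-index< at))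
fourling-corner-colour (r ∷ r' ∷ T) (fl-cons _ _ rest) (below (below c)) nothing-right nothing-below =
  trans (ℤ.neg-involutive _)
        (fourling-corner-colour T rest c (nothing-right ∘ below ∘ below) (nothing-below ∘ below ∘ below))

SYT-last-cell-colour : ∀ {D T i j} → IsFourling D → IsSYT D T → T [ i ][ j ]= size D → colour i j ≡ + 1
SYT-last-cell-colour {D} {T} fourling syt@(shape , _ , rows , columns) n-at =
  fourling-corner-colour T (subst IsFourling (sym shape) fourling) n-at
    (λ w-at → <⇒≱ (cell-right rows n-at w-at) (proj₂ (SYT-entry-bounds syt w-at)))
    (λ w-at → <⇒≱ (cell-below columns n-at w-at) (proj₂ (SYT-entry-bounds syt w-at)))

sgn-sweep : ∀ {D T} → IsShape D → IsFourling D → 1 ≤ size D → IsSYT D T →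
            sgn (sweep 1 (size D ∸ 1) T) ≡ - sgn T
sgn-sweep {D} {T} shape fourling 1≤n syt =
  conclude (sweep-SignedColour 1 m ≤-refl (≤-reflexive 1+m≡n) syt start)
  where
  m = size D ∸ 1
  P = sweep 1 m T
  1+m≡n : 1 + m ≡ size D
  1+m≡n = m+[n∸m]≡n 1≤n
  start : SignedColour T 1 (sgn T)
  start = 0 , 0 , SYT-first-cell shape 1≤n syt , sym (ℤ.*-identityʳ (sgn T))
  negOnePow-m : negOnePow m ≡ - + 1
  negOnePow-m = trans (sym (ℤ.neg-involutive _))
    (cong -_ (negOnePow-even (subst (2 ∣_) (sym 1+m≡n) (fourling-size-even fourling))))
  conclude : SignedColour P (1 + m) (negOnePow m *ℤ sgn T) → sgn P ≡ - sgn T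
  conclude (i , j , n-at , colour≡) = begin
    sgn P                     ≡⟨ ℤ.*-identityʳ (sgn P) ⟨
    sgn P *ℤ + 1              ≡⟨ cong (sgn P *ℤ_) last-colour ⟨
    sgn P *ℤ colour i j       ≡⟨ colour≡ ⟨
    negOnePow m *ℤ sgn T      ≡⟨ cong (_*ℤ sgn T) negOnePow-m ⟩
    - + 1 *ℤ sgn T            ≡⟨ ℤ.-1*i≡-i (sgn T) ⟩
    - sgn T                   ∎
    where
    open ≡-Reasoning
    last-colour : colour i j ≡ + 1
    last-colour = SYT-last-cell-colour fourling (sweep-SYT 1 m ≤-refl (≤-reflexive 1+m≡n) syt)
                                       (subst (P [ i ][ j ]=_) 1+m≡n n-at)

lemma6p5 : (D : List ℕ) → IsShape D → IsFourling D → D ≢ []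
         → (ts : List Filling) → Unique ts → (∀ T → (T ∈ ts) ⇔ IsSYT D T)
         → sumℤ (map sgn ts) ≡ + 0
lemma6p5 D shape fourling D≢[] ts uniq ts⇔SYT =
  sumℤ-sign-reversing sgn uniq (unsweep-sweep 1 m) (sweep-unsweep 1 m)
    (λ T∈ → from (sweep-SYT 1 m ≤-refl bound (to T∈)))
    (λ T∈ → from (unsweep-SYT 1 m ≤-refl bound (to T∈)))
    (λ T∈ → sgn-sweep shape fourling 1≤n (to T∈))
  where
  1≤n = shape-size-positive shape D≢[]
  m = size D ∸ 1
  bound : 1 + m ≤ size D
  bound = ≤-reflexive (m+[n∸m]≡n 1≤n)
  to : ∀ {T} → T ∈ ts → IsSYT D T
  to {T} = Equivalence.to (ts⇔SYT T)
  from : ∀ {T} → IsSYT D T → T ∈ ts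
  from {T} = Equivalence.from (ts⇔SYT T)
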